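{- Let $T_1,\dots,T_k$ be tree presentations and $T=s(T_1,\dots,T_k)$. Then $\mathrm{Aut}(\mathcal{L}^*_T)\cong\mathrm{Aut}(\mathcal{L}^*_{T_1})\times\cdots\times\mathrm{Aut}(\mathcal{L}^*_{T_k})$.
   Context: Tree presentations are finite trees whose nodes are finite sequences of positive integers, each node labelled $\ell$ (leaf), $s$ (sum) or $\sigma$ (shuffle), defined inductively: $1$ is the tree consisting only of the root $\langle\rangle$, labelled $\ell$; if $T_1,\dots,T_k$ ($k\ge1$) are tree presentations then $s(T_1,\dots,T_k)$ (resp. $\sigma(T_1,\dots,T_k)$) is the tree whose nodes are the root $\langle\rangle$, labelled $s$ (resp. $\sigma$), together with the nodes $\langle i\rangle^\frown t$ for $1\le i\le k$ and $t\in T_i$, labelled as $t$ is in $T_i$. For a sequence $u$ and $i\le|u|$, $u\upharpoonright i$ is its initial segment of length $i$. Fix once and for all a partition $\langle\mathbb{Q}_n\rangle_{n\ge1}$ of $\mathbb{Q}$ into sets each dense in $\mathbb{Q}$, with $n\in\mathbb{Q}_n$. For $q\in\mathbb{Q}$ let $\#(q)$ be the $n$ with $q\in\mathbb{Q}_n$; for $\bar r=\langle r_0,\dots,r_{m-1}\rangle$ let $\#(\bar r)=\langle\#(r_0),\dots,\#(r_{m-1})\rangle$. For a tree presentation $T$, $\mathcal{L}_T$ is the set of finite sequences $\bar r$ of rationals such that $\#(\bar r)$ is a leaf of $T$ and for each $i<|\bar r|$, if $\#(\bar r)\upharpoonright i$ is a sum node then $r_i=\#(r_i)$, ordered lexicographically.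 For a node $t$, $D_t$ is the set of $\bar r\in\mathcal{L}_T$ such that $\#(\bar r)$ extends $t$. $\mathcal{L}^*_T$ is the expansion of $(\mathcal{L}_T,<)$ by binary relations $E_t$ ($t\in T$), where $\bar r\,E_t\,\bar s$ iff $\bar r,\bar s\in D_t$ and $\bar r\upharpoonright|t|=\bar s\upharpoonright|t|$. -}

module Defs where

open import Data.Nat using (ℕ; zero; suc; _≥_; _<?_)
open import Data.Fin using (Fin; toℕ; fromℕ<)
open import Data.List using (List; []; _∷_; map; take; length; _++_; lookup)
open import Data.Maybe using (Maybe; just; nothing)
open import Data.Product using (Σ; ∃; _×_; _,_; proj₁)
open import Data.Integer using (+_)
open import Data.Rational using (ℚ; _/_)
import Data.Rational as ℚ
open import Data.List.Relation.Binary.Lex.Strict using (Lex-<)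
open import Relation.Binary.PropositionalEquality using (_≡_)
open import Relation.Nullary using (yes; no)
open import Function using (_⇔_; _∘_)

-- Tree presentations.
-- `sum k f` / `shuf k f` is s(T_1,…,T_{k+1}) / σ(T_1,…,T_{k+1}) with
-- T_i = f (i-1); the `suc` encodes the requirement of ≥ 1 child.

data TP : Set where
  leaf : TP
  sum  : (k : ℕ) → (Fin (suc k) → TP) → TP
  shuf : (k : ℕ) → (Fin (suc k) → TP) → TP

data Label : Set where
  ℓ s σ : Label

-- child index i (a positive integer, 1 ≤ i ≤ k+1) as an element of Fin (suc k)
toChild : (k : ℕ) → ℕ → Maybe (Fin (suc k))
toChild k zero = nothing
toChild k (suc j) with j <? suc k
... | yes p = just (fromℕ< p)
... | no _  = nothing

-- Nodes are finite sequences of positive integers; `label T t` is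
-- `just L` iff t is a node of T labelled L, and `nothing` if t ∉ T.
label : TP → List ℕ → Maybe Label
label leaf       []      = just ℓ
label leaf       (_ ∷ _) = nothing
label (sum k f)  []      = just s
label (sum k f)  (i ∷ t) with toChild k i
... | just j  = label (f j) t
... | nothing = nothing
label (shuf k f) []      = just σ
label (shuf k f) (i ∷ t) with toChild k i
... | just j  = label (f j) t
... | nothing = nothing

IsNode : TP → List ℕ → Set
IsNode T t = Σ Label λ L → label T t ≡ just L

-- A partition ⟨ℚ_n⟩_{n≥1} of ℚ into dense sets with n ∈ ℚ_n,
-- given by the map # : ℚ → ℕ (q ∈ ℚ_{# q}).

ℕ→ℚ : ℕ → ℚ
ℕ→ℚ n = + n / 1

record Partition : Set where
  field
    #      : ℚ → ℕ
    #-pos  : ∀ q → # q ≥ 1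
    dense  : ∀ n → n ≥ 1 → ∀ a b → a ℚ.< b →
             ∃ λ q → a ℚ.< q × q ℚ.< b × # q ≡ n
    #-nat  : ∀ n → n ≥ 1 → # (ℕ→ℚ n) ≡ n

module _ (P : Partition) where
  open Partition P

  #s : List ℚ → List ℕ
  #s = map #

  InL : TP → List ℚ → Set
  InL T r = (label T (#s r) ≡ just ℓ)
          × (∀ (i : Fin (length r)) → label T (take (toℕ i) (#s r)) ≡ just s →
               lookup r i ≡ ℕ→ℚ (# (lookup r i)))

  L : TP → Set
  L T = Σ (List ℚ) (InL T)

  module _ (T : TP) where
    _<L_ : L T → L T → Set
    x <L y = Lex-< _≡_ ℚ._<_ (proj₁ x) (proj₁ y)

    InD : List ℕ → L T → Set
    InD t x = ∃ λ u → #s (proj₁ x) ≡ t ++ u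

    E : List ℕ → L T → L T → Set
    E t x y = InD t x × InD t y × take (length t) (proj₁ x) ≡ take (length t) (proj₁ y)

    _≈L_ : L T → L T → Set
    x ≈L y = proj₁ x ≡ proj₁ y

    record Aut : Set where
      field
        fun    : L T → L T
        inv    : L T → L T
        fun-cong : ∀ {x y} → x ≈L y → fun x ≈L fun y
        inv-cong : ∀ {x y} → x ≈L y → inv x ≈L inv y
        inv-fun  : ∀ x → inv (fun x) ≈L x
        fun-inv  : ∀ x → fun (inv x) ≈L x
        pres-<   : ∀ x y → (x <L y) ⇔ (fun x <L fun y)
        pres-E   : ∀ t → IsNode T t → ∀ x y → E t x y ⇔ E t (fun x) (fun y)
    open Aut public

    _≈A_ : Aut → Aut → Set
    f ≈A g = ∀ x → fun f x ≈L fun g x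

  -- Aut T₀ ≅ ∏_{i} Aut (Ts i) as groups (w.r.t. the pointwise equalities):
  -- a well-defined, multiplicative, injective and surjective map.
  -- (Multiplicativity: whenever h = f ∘ g, Φ h = Φ f ∘ Φ g componentwise;
  -- identity and inverses are then automatically preserved.)
  record AutIsoProduct (T₀ : TP) {n : ℕ} (Ts : Fin n → TP) : Set where
    field
      Φ        : Aut T₀ → ((i : Fin n) → Aut (Ts i))
      Φ-cong   : ∀ f g → _≈A_ T₀ f g → ∀ i → _≈A_ (Ts i) (Φ f i) (Φ g i)
      Φ-hom    : ∀ f g h → (∀ x → _≈L_ T₀ (fun h x) (fun f (fun g x))) →
                 ∀ i y → _≈L_ (Ts i) (fun (Φ h i) y) (fun (Φ f i) (fun (Φ g i) y))
      Φ-inj    : ∀ f g → (∀ i → _≈A_ (Ts i) (Φ f i) (Φ g i)) → _≈A_ T₀ f g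
      Φ-surj   : ∀ (h : (i : Fin n) → Aut (Ts i)) →
                 ∃ λ f → ∀ i → _≈A_ (Ts i) (Φ f i) (h i)

-- For T = s(T₁,…,T_k), the first entry of every r̄ ∈ 𝓛_T is a natural number i
-- (the root is a sum node), and r̄ = ⟨i⟩⌢r̄' with r̄' ∈ 𝓛_{T_i}.  So 𝓛_T is the
-- ordered sum of copies of the 𝓛_{T_i}, the copies being the sets D_⟨i⟩, and
-- E_{⟨i⟩⌢t} is E_t inside the i-th copy.  As x E_⟨i⟩ x just says x ∈ D_⟨i⟩, an
-- automorphism of 𝓛*_T maps every copy onto itself and so restricts to
-- automorphisms of the 𝓛*_{T_i}; conversely automorphisms of the 𝓛*_{T_i} glue
-- copywise to one of 𝓛*_T, and restricting and gluing are mutually inverse.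

module Submission where

open import Defs
open import Data.Nat using (ℕ; zero; suc; s≤s; z≤n; _<?_)
open import Data.Nat.Properties using (suc-injective)
open import Data.Fin using (Fin; toℕ; fromℕ<)
import Data.Fin as Fin
open import Data.Fin.Properties using (toℕ-injective; toℕ-fromℕ<; toℕ<n)
open import Data.List using (List; []; _∷_; _++_; drop; take; length; lookup)
open import Data.List.Properties using (∷-injectiveˡ; ∷-injectiveʳ)
open import Data.Maybe using (just)
open import Data.Product using (∃; _×_; _,_; proj₁; proj₂)
open import Data.Rational using (ℚ)
import Data.Rational as ℚ
open import Data.Rational.Properties using (<-irrefl)
open import Data.List.Relation.Binary.Lex.Strict using (Lex-<; this; next)
open import Relation.Binary.PropositionalEquality
open import Relation.Nullary using (yes; no; ¬_; contradiction)
open import Function using (_⇔_; mk⇔; Equivalence)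
import Function.Properties.Equivalence as ⇔

open Equivalence using (to; from)

infixr 4 _⟫_
_⟫_ : ∀ {A B C : Set} → A ⇔ B → B ⇔ C → A ⇔ C
_⟫_ = ⇔.trans

⇔-subst₂ : ∀ {A B : Set} (R : A → B → Set) {a a' b b'} → a ≡ a' → b ≡ b' → R a b ⇔ R a' b'
⇔-subst₂ R refl refl = ⇔.refl

module _ {A : Set} {_<_ : A → A → Set} where

  private
    _<ˡ_ : List A → List A → Set
    _<ˡ_ = Lex-< _≡_ _<_

  Lex-∷-cong : ∀ {x y xs ys xs' ys'} → (x ≡ y → (xs <ˡ ys) ⇔ (xs' <ˡ ys')) →
               ((x ∷ xs) <ˡ (y ∷ ys)) ⇔ ((x ∷ xs') <ˡ (y ∷ ys'))
  Lex-∷-cong {x} {y} tails =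
    mk⇔ (mono (λ e → to (tails e))) (mono (λ e → from (tails e)))
    where
    mono : ∀ {as bs as' bs'} → (x ≡ y → as <ˡ bs → as' <ˡ bs') →
           (x ∷ as) <ˡ (y ∷ bs) → (x ∷ as') <ˡ (y ∷ bs')
    mono _ (this x<y)     = this x<y
    mono f (next x≡y lt) = next x≡y (f x≡y lt)

  Lex-∷-same : (∀ {x} → ¬ x < x) → ∀ {x xs ys} → ((x ∷ xs) <ˡ (x ∷ ys)) ⇔ (xs <ˡ ys)
  Lex-∷-same irrefl = mk⇔ drop-head (next refl)
    where
    drop-head : ∀ {x xs ys} → (x ∷ xs) <ˡ (x ∷ ys) → xs <ˡ ys
    drop-head (this x<x)  = contradiction x<x irrefl
    drop-head (next _ lt) = lt

toChild-suc-toℕ : ∀ k (i : Fin (suc k)) → toChild k (suc (toℕ i)) ≡ just i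
toChild-suc-toℕ k i with toℕ i <? suc k
... | yes p  = cong just (toℕ-injective (toℕ-fromℕ< p))
... | no i≮ = contradiction (toℕ<n i) i≮

label-sum-child : ∀ k (f : Fin (suc k) → TP) i t → label (sum k f) (suc (toℕ i) ∷ t) ≡ label (f i) t
label-sum-child k f i t rewrite toChild-suc-toℕ k i = refl

root-IsNode : ∀ U → IsNode U []
root-IsNode leaf       = ℓ , refl
root-IsNode (sum _ _)  = s , refl
root-IsNode (shuf _ _) = σ , refl

child-IsNode : ∀ {k f i t} → IsNode (f i) t → IsNode (sum k f) (suc (toℕ i) ∷ t)
child-IsNode {k} {f} {i} {t} (L , e) = L , trans (label-sum-child k f i t) e

sum-IsNode-cons : ∀ {k f j t} → IsNode (sum k f) (j ∷ t) → ∃ λ i → j ≡ suc (toℕ i) × IsNode (f i) t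
sum-IsNode-cons {k} {j = zero}  (_ , ())
sum-IsNode-cons {k} {j = suc j} (L , e) with j <? suc k
... | yes p = fromℕ< p , cong suc (sym (toℕ-fromℕ< p)) , L , e
... | no _  with () ← e

module _ (P : Partition) where
  open Partition P

  -- D_t and E_t on raw sequences: InD P T t x and E P T t x y unfold to
  -- Dˡ t (proj₁ x) and Eˡ t (proj₁ x) (proj₁ y), whatever T is.
  Dˡ : List ℕ → List ℚ → Set
  Dˡ t r = ∃ λ u → #s P r ≡ t ++ u

  Eˡ : List ℕ → List ℚ → List ℚ → Set
  Eˡ t r r' = Dˡ t r × Dˡ t r' × take (length t) r ≡ take (length t) r'

  Eˡ-[] : ∀ r r' → Eˡ [] r r'
  Eˡ-[] r r' = (#s P r , refl) , (#s P r' , refl) , refl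

  Eˡ-∷ : ∀ {j t h h' r r'} → h ≡ ℕ→ℚ (# h) → h' ≡ ℕ→ℚ (# h') →
         Eˡ (j ∷ t) (h ∷ r) (h' ∷ r') ⇔ (# h ≡ j × # h' ≡ j × Eˡ t r r')
  Eˡ-∷ h-fixed h'-fixed = mk⇔
    (λ { ((u , e) , (u' , e') , same) →
         ∷-injectiveˡ e , ∷-injectiveˡ e' ,
         (u , ∷-injectiveʳ e) , (u' , ∷-injectiveʳ e') , ∷-injectiveʳ same })
    (λ { (#h≡j , #h'≡j , (u , e) , (u' , e') , same) →
         (u , cong₂ _∷_ #h≡j e) , (u' , cong₂ _∷_ #h'≡j e') ,
         cong₂ _∷_ (trans h-fixed (trans (cong ℕ→ℚ (trans #h≡j (sym #h'≡j))) (sym h'-fixed))) same })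

  module _ {T : TP} (f : Aut P T) {t} (node : IsNode T t) where

    fun-InD : ∀ {x} → InD P T t x → InD P T t (fun f x)
    fun-InD {x} d = proj₁ (to (pres-E f t node x x) (d , d , refl))

    inv-InD : ∀ {x} → InD P T t x → InD P T t (inv f x)
    inv-InD {x} d = proj₁ (from (pres-E f t node (inv f x) (inv f x)) (d' , d' , refl))
      where
      d' : InD P T t (fun f (inv f x))
      d' = subst (Dˡ t) (sym (fun-inv f x)) d

  module Summands (k : ℕ) (Ts : Fin (suc k) → TP) where

    T : TP
    T = sum k Ts

    ⟨_⟩ : Fin (suc k) → List ℕ
    ⟨ i ⟩ = suc (toℕ i) ∷ []

    tag : Fin (suc k) → ℚ
    tag i = ℕ→ℚ (suc (toℕ i))

    #-tag : ∀ i → # (tag i) ≡ suc (toℕ i)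
    #-tag i = #-nat (suc (toℕ i)) (s≤s z≤n)

    tag-fixed : ∀ i → tag i ≡ ℕ→ℚ (# (tag i))
    tag-fixed i = cong ℕ→ℚ (sym (#-tag i))

    #-tag-injective : ∀ {i j} → # (tag i) ≡ suc (toℕ j) → i ≡ j
    #-tag-injective {i} e = toℕ-injective (suc-injective (trans (sym (#-tag i)) e))

    tag-injective : ∀ {i j} → tag i ≡ tag j → i ≡ j
    tag-injective {i} {j} e = #-tag-injective (trans (cong # e) (#-tag j))

    summand-IsNode : ∀ i → IsNode T ⟨ i ⟩
    summand-IsNode i = child-IsNode {k} {Ts} {i} (root-IsNode (Ts i))

    label-summand : ∀ {j i} t → j ≡ suc (toℕ i) → label T (j ∷ t) ≡ label (Ts i) t
    label-summand {i = i} t refl = label-sum-child k Ts i t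

    inject : ∀ i → L P (Ts i) → L P T
    inject i y = tag i ∷ proj₁ y , label-tagged , sum-positions
      where
      label-tagged : label T (# (tag i) ∷ #s P (proj₁ y)) ≡ just ℓ
      label-tagged = trans (label-summand _ (#-tag i)) (proj₁ (proj₂ y))
      sum-positions : ∀ n → label T (take (toℕ n) (#s P (tag i ∷ proj₁ y))) ≡ just s →
                      lookup (tag i ∷ proj₁ y) n ≡ ℕ→ℚ (# (lookup (tag i ∷ proj₁ y) n))
      sum-positions Fin.zero    _ = tag-fixed i
      sum-positions (Fin.suc n) e = proj₂ (proj₂ y) n (trans (sym (label-summand _ (#-tag i))) e)

    inject-InD : ∀ i y → InD P T ⟨ i ⟩ (inject i y)
    inject-InD i y = #s P (proj₁ y) , cong (_∷ #s P (proj₁ y)) (#-tag i)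

    InD-unique : ∀ {i j x} → InD P T ⟨ i ⟩ x → InD P T ⟨ j ⟩ x → i ≡ j
    InD-unique (_ , e) (_ , e') = toℕ-injective (suc-injective (∷-injectiveˡ (trans (sym e) e')))

    summand : (x : L P T) → ∃ λ i → InD P T ⟨ i ⟩ x
    summand ([] , () , _)
    summand (r ∷ rs , lab , _) =
      let i , #r≡ , _ = sum-IsNode-cons {k} {Ts} {# r} {#s P rs} (ℓ , lab)
      in  i , #s P rs , cong (_∷ #s P rs) #r≡

    -- The underlying sequence of restrict x d is drop 1 (proj₁ x) by computation,
    -- independently of the proof d.
    restrict : ∀ {i} (x : L P T) → InD P T ⟨ i ⟩ x → L P (Ts i)
    restrict x d = drop 1 (proj₁ x) , tail-InL x d
      where
      tail-InL : ∀ {i} (x : L P T) → InD P T ⟨ i ⟩ x → InL P (Ts i) (drop 1 (proj₁ x))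
      tail-InL ([] , () , _)
      tail-InL (r ∷ rs , lab , sums) (_ , e) =
        trans (sym (label-summand _ (∷-injectiveˡ e))) lab ,
        λ n e' → sums (Fin.suc n) (trans (label-summand _ (∷-injectiveˡ e)) e')

    inject-restrict : ∀ {i} x (d : InD P T ⟨ i ⟩ x) → _≈L_ P T (inject i (restrict x d)) x
    inject-restrict ([] , () , _)
    inject-restrict (r ∷ rs , _ , sums) (_ , e) =
      cong (_∷ rs) (sym (trans (sums Fin.zero refl) (cong ℕ→ℚ (∷-injectiveˡ e))))

    _<ˡ_ : List ℚ → List ℚ → Set
    _<ˡ_ = Lex-< _≡_ ℚ._<_

    Eˡ-tags : ∀ {i i₁ i₂ t r r'} →
              Eˡ (⟨ i ⟩ ++ t) (tag i₁ ∷ r) (tag i₂ ∷ r') ⇔ (i₁ ≡ i × i₂ ≡ i × Eˡ t r r')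
    Eˡ-tags {i} {i₁} {i₂} = Eˡ-∷ (tag-fixed i₁) (tag-fixed i₂) ⟫ mk⇔
      (λ { (p , p' , e) → #-tag-injective p , #-tag-injective p' , e })
      (λ { (refl , refl , e) → #-tag i , #-tag i , e })

    tag-<ˡ : ∀ i r r' → (r <ˡ r') ⇔ ((tag i ∷ r) <ˡ (tag i ∷ r'))
    tag-<ˡ i r r' = ⇔.sym (Lex-∷-same (<-irrefl refl))

    tag-Eˡ : ∀ i t r r' → Eˡ t r r' ⇔ Eˡ (⟨ i ⟩ ++ t) (tag i ∷ r) (tag i ∷ r')
    tag-Eˡ i t r r' = mk⇔ (λ e → from (Eˡ-tags {i} {i} {i}) (refl , refl , e))
                          (λ e → proj₂ (proj₂ (to (Eˡ-tags {i} {i} {i}) e)))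

    module Restriction (f : Aut P T) (i : Fin (suc k)) where

      φ-InD : ∀ y → InD P T ⟨ i ⟩ (fun f (inject i y))
      φ-InD y = fun-InD f (summand-IsNode i) (inject-InD i y)

      ψ-InD : ∀ y → InD P T ⟨ i ⟩ (inv f (inject i y))
      ψ-InD y = inv-InD f (summand-IsNode i) (inject-InD i y)

      φ ψ : L P (Ts i) → L P (Ts i)
      φ y = restrict (fun f (inject i y)) (φ-InD y)
      ψ y = restrict (inv f (inject i y)) (ψ-InD y)

      inject-φ : ∀ y → _≈L_ P T (inject i (φ y)) (fun f (inject i y))
      inject-φ y = inject-restrict (fun f (inject i y)) (φ-InD y)

      inject-ψ : ∀ y → _≈L_ P T (inject i (ψ y)) (inv f (inject i y))
      inject-ψ y = inject-restrict (inv f (inject i y)) (ψ-InD y)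

      φ-preserves : (R R' : List ℚ → List ℚ → Set) →
        (∀ r r' → R' r r' ⇔ R (tag i ∷ r) (tag i ∷ r')) →
        (∀ x x' → R (proj₁ x) (proj₁ x') ⇔ R (proj₁ (fun f x)) (proj₁ (fun f x'))) →
        ∀ y y' → R' (proj₁ y) (proj₁ y') ⇔ R' (proj₁ (φ y)) (proj₁ (φ y'))
      φ-preserves R R' tagged f-preserves y y' =
        tagged _ _
        ⟫ f-preserves (inject i y) (inject i y')
        ⟫ ⇔-subst₂ R (sym (inject-φ y)) (sym (inject-φ y'))
        ⟫ ⇔.sym (tagged _ _)

      aut : Aut P (Ts i)
      aut = record
        { fun      = φ
        ; inv      = ψ
        ; fun-cong = λ e → cong (drop 1) (fun-cong f (cong (tag i ∷_) e))
        ; inv-cong = λ e → cong (drop 1) (inv-cong f (cong (tag i ∷_) e))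
        ; inv-fun  = λ y → cong (drop 1) (trans (inv-cong f (inject-φ y)) (inv-fun f (inject i y)))
        ; fun-inv  = λ y → cong (drop 1) (trans (fun-cong f (inject-ψ y)) (fun-inv f (inject i y)))
        ; pres-<   = φ-preserves _<ˡ_ _<ˡ_ (tag-<ˡ i) (pres-< f)
        ; pres-E   = λ t node → φ-preserves (Eˡ (⟨ i ⟩ ++ t)) (Eˡ t) (tag-Eˡ i t)
                                  (pres-E f _ (child-IsNode {k} {Ts} {i} node))
        }

    restrict-aut : Aut P T → (i : Fin (suc k)) → Aut P (Ts i)
    restrict-aut = Restriction.aut

    restrict-aut-cong : ∀ f g → _≈A_ P T f g → ∀ i → _≈A_ P (Ts i) (restrict-aut f i) (restrict-aut g i)
    restrict-aut-cong f g f≈g i y = cong (drop 1) (f≈g (inject i y))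

    restrict-aut-hom : ∀ f g h → (∀ x → _≈L_ P T (fun h x) (fun f (fun g x))) →
                       ∀ i y → _≈L_ P (Ts i) (fun (restrict-aut h i) y)
                                             (fun (restrict-aut f i) (fun (restrict-aut g i) y))
    restrict-aut-hom f g h h≈fg i y =
      cong (drop 1) (trans (h≈fg (inject i y)) (fun-cong f (sym (Restriction.inject-φ g i y))))

    restrict-aut-injective : ∀ f g → (∀ i → _≈A_ P (Ts i) (restrict-aut f i) (restrict-aut g i)) →
                             _≈A_ P T f g
    restrict-aut-injective f g f≈g x = begin
      proj₁ (fun f x)                               ≡⟨ fun-cong f (sym (inject-restrict x d)) ⟩
      proj₁ (fun f (inject i y))                    ≡⟨ sym (Restriction.inject-φ f i y) ⟩
      tag i ∷ proj₁ (fun (restrict-aut f i) y)      ≡⟨ cong (tag i ∷_) (f≈g i y) ⟩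
      tag i ∷ proj₁ (fun (restrict-aut g i) y)      ≡⟨ Restriction.inject-φ g i y ⟩
      proj₁ (fun g (inject i y))                    ≡⟨ fun-cong g (inject-restrict x d) ⟩
      proj₁ (fun g x)                               ∎
      where
      open ≡-Reasoning
      i : Fin (suc k)
      i = proj₁ (summand x)
      d : InD P T ⟨ i ⟩ x
      d = proj₂ (summand x)
      y : L P (Ts i)
      y = restrict x d

    Family : Set
    Family = ∀ i → L P (Ts i) → L P (Ts i)

    FamilyCong : Family → Set
    FamilyCong F = ∀ i {y y'} → _≈L_ P (Ts i) y y' → _≈L_ P (Ts i) (F i y) (F i y')

    glue : Family → L P T → L P T
    glue F x = inject (proj₁ (summand x)) (F _ (restrict x (proj₂ (summand x))))

    glue-summand : ∀ F → FamilyCong F → ∀ {i} x (d : InD P T ⟨ i ⟩ x) →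
                   _≈L_ P T (glue F x) (inject i (F i (restrict x d)))
    glue-summand F F-cong x d with summand x
    ... | j , d' with refl ← InD-unique {x = x} d' d = cong (tag j ∷_) (F-cong j refl)

    glue-cong : ∀ F → FamilyCong F → ∀ {x x'} → _≈L_ P T x x' → _≈L_ P T (glue F x) (glue F x')
    glue-cong F F-cong {x} {x'} x≈x' = begin
      proj₁ (glue F x)                               ≡⟨ glue-summand F F-cong x d ⟩
      tag i ∷ proj₁ (F i (restrict x d))             ≡⟨ cong (tag i ∷_) (F-cong i (cong (drop 1) x≈x')) ⟩
      tag i ∷ proj₁ (F i (restrict x' d'))           ≡⟨ glue-summand F F-cong x' d' ⟨
      proj₁ (glue F x')                              ∎
      where
      open ≡-Reasoning
      i : Fin (suc k)
      i = proj₁ (summand x)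
      d : InD P T ⟨ i ⟩ x
      d = proj₂ (summand x)
      d' : InD P T ⟨ i ⟩ x'
      d' = subst (Dˡ ⟨ i ⟩) x≈x' d

    glue-inverse : ∀ F G → FamilyCong F → FamilyCong G → (∀ i y → _≈L_ P (Ts i) (G i (F i y)) y) →
                   ∀ x → _≈L_ P T (glue G (glue F x)) x
    glue-inverse F G F-cong G-cong G∘F≈id x = begin
      proj₁ (glue G (glue F x))                      ≡⟨ glue-summand G G-cong (glue F x) d' ⟩
      tag i ∷ proj₁ (G i (restrict (glue F x) d'))   ≡⟨ cong (tag i ∷_) (G-cong i (cong (drop 1) Fx≈)) ⟩
      tag i ∷ proj₁ (G i (F i y))                    ≡⟨ cong (tag i ∷_) (G∘F≈id i y) ⟩
      tag i ∷ proj₁ y                                ≡⟨ inject-restrict x d ⟩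
      proj₁ x                                        ∎
      where
      open ≡-Reasoning
      i : Fin (suc k)
      i = proj₁ (summand x)
      d : InD P T ⟨ i ⟩ x
      d = proj₂ (summand x)
      y : L P (Ts i)
      y = restrict x d
      Fx≈ : _≈L_ P T (glue F x) (inject i (F i y))
      Fx≈ = glue-summand F F-cong x d
      d' : InD P T ⟨ i ⟩ (glue F x)
      d' = subst (Dˡ ⟨ i ⟩) (sym Fx≈) (inject-InD i (F i y))

    glue-< : ∀ F → FamilyCong F → (∀ i y y' → _<L_ P (Ts i) y y' ⇔ _<L_ P (Ts i) (F i y) (F i y')) →
             ∀ x x' → _<L_ P T x x' ⇔ _<L_ P T (glue F x) (glue F x')
    glue-< F F-cong F-< x x' =
      ⇔-subst₂ _<ˡ_ (sym (inject-restrict x d)) (sym (inject-restrict x' d'))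
      ⟫ Lex-∷-cong (λ e → same-summand (restrict x d) (restrict x' d') (tag-injective e))
      ⟫ ⇔-subst₂ _<ˡ_ (sym (glue-summand F F-cong x d)) (sym (glue-summand F F-cong x' d'))
      where
      d : InD P T ⟨ proj₁ (summand x) ⟩ x
      d = proj₂ (summand x)
      d' : InD P T ⟨ proj₁ (summand x') ⟩ x'
      d' = proj₂ (summand x')
      same-summand : ∀ {i i'} (y : L P (Ts i)) (y' : L P (Ts i')) → i ≡ i' →
                     (proj₁ y <ˡ proj₁ y') ⇔ (proj₁ (F i y) <ˡ proj₁ (F i' y'))
      same-summand y y' refl = F-< _ y y'

    glue-E : ∀ F → FamilyCong F →
             (∀ i t → IsNode (Ts i) t → ∀ y y' → E P (Ts i) t y y' ⇔ E P (Ts i) t (F i y) (F i y')) →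
             ∀ t → IsNode T t → ∀ x x' → E P T t x x' ⇔ E P T t (glue F x) (glue F x')
    glue-E F F-cong F-E []      _    x x' = mk⇔ (λ _ → Eˡ-[] _ _) (λ _ → Eˡ-[] _ _)
    glue-E F F-cong F-E (j ∷ t) node x x' with sum-IsNode-cons {k} {Ts} {j} {t} node
    ... | i , refl , node' =
      ⇔-subst₂ (Eˡ (⟨ i ⟩ ++ t)) (sym (inject-restrict x d)) (sym (inject-restrict x' d'))
      ⟫ Eˡ-tags {i} {i₁} {i₂}
      ⟫ in-summand (restrict x d) (restrict x' d')
      ⟫ ⇔.sym (Eˡ-tags {i} {i₁} {i₂})
      ⟫ ⇔-subst₂ (Eˡ (⟨ i ⟩ ++ t)) (sym (glue-summand F F-cong x d)) (sym (glue-summand F F-cong x' d'))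
      where
      i₁ i₂ : Fin (suc k)
      i₁ = proj₁ (summand x)
      i₂ = proj₁ (summand x')
      d : InD P T ⟨ i₁ ⟩ x
      d = proj₂ (summand x)
      d' : InD P T ⟨ i₂ ⟩ x'
      d' = proj₂ (summand x')
      in-summand : ∀ {i₁ i₂} (y : L P (Ts i₁)) (y' : L P (Ts i₂)) →
        (i₁ ≡ i × i₂ ≡ i × Eˡ t (proj₁ y) (proj₁ y')) ⇔
        (i₁ ≡ i × i₂ ≡ i × Eˡ t (proj₁ (F i₁ y)) (proj₁ (F i₂ y')))
      in-summand y y' = mk⇔
        (λ { (refl , refl , e) → refl , refl , to   (F-E i t node' y y') e })
        (λ { (refl , refl , e) → refl , refl , from (F-E i t node' y y') e })

    funs invs : (∀ i → Aut P (Ts i)) → Family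
    funs h i = fun (h i)
    invs h i = inv (h i)

    funs-cong : ∀ h → FamilyCong (funs h)
    funs-cong h i = fun-cong (h i)

    invs-cong : ∀ h → FamilyCong (invs h)
    invs-cong h i = inv-cong (h i)

    glue-aut : (∀ i → Aut P (Ts i)) → Aut P T
    glue-aut h = record
      { fun      = glue (funs h)
      ; inv      = glue (invs h)
      ; fun-cong = glue-cong (funs h) (funs-cong h)
      ; inv-cong = glue-cong (invs h) (invs-cong h)
      ; inv-fun  = glue-inverse (funs h) (invs h) (funs-cong h) (invs-cong h) (λ i → inv-fun (h i))
      ; fun-inv  = glue-inverse (invs h) (funs h) (invs-cong h) (funs-cong h) (λ i → fun-inv (h i))
      ; pres-<   = glue-< (funs h) (funs-cong h) (λ i → pres-< (h i))
      ; pres-E   = glue-E (funs h) (funs-cong h) (λ i → pres-E (h i))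
      }

    restrict-glue-aut : ∀ h i → _≈A_ P (Ts i) (restrict-aut (glue-aut h) i) (h i)
    restrict-glue-aut h i y =
      trans (cong (drop 1) (glue-summand (funs h) (funs-cong h) (inject i y) (inject-InD i y)))
            (fun-cong (h i) refl)

lemma6 : (P : Partition) (k : ℕ) (Ts : Fin (suc k) → TP) →
    AutIsoProduct P (sum k Ts) Ts
lemma6 P k Ts = record
  { Φ      = restrict-aut
  ; Φ-cong = restrict-aut-cong
  ; Φ-hom  = restrict-aut-hom
  ; Φ-inj  = restrict-aut-injective
  ; Φ-surj = λ h → glue-aut h , restrict-glue-aut h
  }
  where open Summands P k Ts
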